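{- Let $T$ be a $k$-hypertournament with $n$ vertices, where $3\leq k\leq n-1$, and let $i\geq 1$, $j\geq 2$ be integers. Then $C_{i,j}(T)=C_{1,2}(T)$.
   Context: Given integers $n\geq k>1$, a $k$-hypertournament on $n$ vertices is a pair $T=(V,A)$ where $|V|=n$ and $A$ is a set of $k$-tuples of distinct vertices (arcs) such that for every $k$-subset $S$ of $V$, $A$ contains exactly one of the $k!$ $k$-tuples whose entries are the elements of $S$. A path in $T$ is a sequence $v_1a_1v_2a_2\cdots a_{t-1}v_t$ of distinct vertices $v_1,\dots,v_t$ ($t\geq1$) and distinct arcs $a_1,\dots,a_{t-1}$ such that $v_i$ precedes $v_{i+1}$ in $a_i$; its length $l(\cdot)$ is the number $t-1$ of arcs, and it is an $(x,y)$-path if $v_1=x$, $v_t=y$. For integers $i,j\geq1$, the $(i,j)$-step competition graph $C_{i,j}(T)$ is the graph on $V(T)$ in which $xy$ is an edge if and only if there exist a vertex $z\neq x,y$, an $(x,z)$-path $P$ and a $(y,z)$-path $Q$ such that: $y\notin V(P)$ and $x\notin V(Q)$; either ($l(P)\leq i$ and $l(Q)\leq j$) or ($l(Q)\leq i$ and $l(P)\leq j$); and $P$, $Q$ have no arc in common. -}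

module Defs where

open import Data.Nat using (ℕ; zero; suc; _≤_)
open import Data.Fin using (Fin; inject₁; fromℕ) renaming (_<_ to _<ᶠ_)
open import Data.Vec using (Vec; lookup)
open import Data.Vec.Membership.Propositional using (_∈_)
open import Data.Product using (Σ; ∃; _×_; _,_)
open import Data.Sum using (_⊎_)
open import Relation.Nullary using (¬_)
open import Relation.Binary.PropositionalEquality using (_≡_; _≢_)
open import Function.Definitions using (Injective)
open import Function.Bundles using (_⇔_)

SameEntries : ∀ {n k} → Vec (Fin n) k → Vec (Fin n) k → Set
SameEntries {n} u w = (a : Fin n) → (a ∈ u) ⇔ (a ∈ w)

DistinctTuple : ∀ {n k} → Vec (Fin n) k → Set
DistinctTuple t = Injective _≡_ _≡_ (lookup t)

record HyperTournament (n k : ℕ) : Set₁ where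
  field
    arc          : Vec (Fin n) k → Set
    arc-distinct : ∀ a → arc a → DistinctTuple a
    -- every k-subset S (given as a tuple of distinct vertices listing S)
    -- has some ordering in A ...
    arc-exists   : ∀ t → DistinctTuple t → ∃ λ a → arc a × SameEntries a t
    arc-unique   : ∀ a b → arc a → arc b → SameEntries a b → a ≡ b
open HyperTournament public

Precedes : ∀ {n k} → Vec (Fin n) k → Fin n → Fin n → Set
Precedes {k = k} a u v = Σ (Fin k) λ p → Σ (Fin k) λ q →
  (p <ᶠ q) × (lookup a p ≡ u) × (lookup a q ≡ v)

record Path {n k : ℕ} (T : HyperTournament n k) (x y : Fin n) : Set where
  field
    len       : ℕ
    vert      : Fin (suc len) → Fin n
    arcs      : Fin len → Vec (Fin n) k
    vert-inj  : Injective _≡_ _≡_ vert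
    arcs-inj  : Injective _≡_ _≡_ arcs
    arcs-in   : ∀ m → arc T (arcs m)
    steps     : ∀ m → Precedes (arcs m) (vert (inject₁ m)) (vert (Data.Fin.suc m))
    start     : vert Data.Fin.zero ≡ x
    end       : vert (fromℕ len) ≡ y
open Path public

NotOn : ∀ {n k} {T : HyperTournament n k} {x y : Fin n} → Fin n → Path T x y → Set
NotOn v P = ∀ m → vert P m ≢ v

ArcDisjoint : ∀ {n k} {T : HyperTournament n k} {x y z w : Fin n} →
  Path T x y → Path T z w → Set
ArcDisjoint P Q = ∀ a b → arcs P a ≢ arcs Q b

CompEdge : ∀ {n k} → ℕ → ℕ → HyperTournament n k → Fin n → Fin n → Set
CompEdge {n} i j T x y =
  Σ (Fin n) λ z → (z ≢ x) × (z ≢ y) ×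
  Σ (Path T x z) λ P → Σ (Path T y z) λ Q →
    NotOn y P × NotOn x Q ×
    ((len P ≤ i × len Q ≤ j) ⊎ (len Q ≤ i × len P ≤ j)) ×
    ArcDisjoint P Q

module Submission where

-- Lowering the length bounds is monotone, so only C_{i,j}(T) ⊆ C_{1,2}(T) needs an
-- argument. Let P and Q witness xy ∈ C_{i,j}(T), with first arcs A ∋ x → x₁ and
-- B ∋ y → y₁. If x₁ = y₁ these two arcs alone witness the edge. Otherwise choose a
-- k-set S ∋ x₁, y₁ that is the entry set of neither A nor B, by leaving out x (if
-- x ∈ B), y (if y ∈ A), both (if n ≥ k + 2), or a fifth vertex (if n = k + 1 ≥ 5).
-- The arc on S orders x₁ and y₁, and so prolongs one of the first steps to the
-- other's head: a path of length 2 against one of length 1. In the remaining case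
-- n = k + 1 ≤ 4 an arc through two vertices other than x, y misses x or y and so
-- is A or B; hence P and Q both stop after one arc, and x₁ = z = y₁.

open import Defs
open import Data.Nat using (ℕ; zero; suc; _+_; _≤_; _<_; _∸_; z≤n; s≤s; _≤?_)
import Data.Nat.Properties as ℕ
open import Data.Fin using (Fin; _≟_) renaming (zero to fzero; suc to fsuc)
import Data.Fin.Properties as Fin
open import Data.Vec using (Vec; []; _∷_; lookup; _++_; allFin)
open import Data.Vec.Properties using (lookup-allFin)
open import Data.Vec.Relation.Unary.Any using (here; there; index; any?)
open import Data.Vec.Relation.Unary.Any.Properties using (lookup-index)
open import Data.Vec.Membership.Propositional using (_∈_; _∉_)
open import Data.Vec.Membership.Propositional.Properties using (∈-lookup; ∈-++⁺ˡ; ∈-++⁺ʳ)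
open import Data.Product using (Σ; ∃; _×_; _,_)
open import Data.Sum using (_⊎_; inj₁; inj₂; [_,_]′)
import Data.Sum as Sum
open import Data.Empty using (⊥-elim)
open import Relation.Nullary using (Dec; yes; no; ¬?)
open import Relation.Nullary.Decidable using (decidable-stable)
open import Relation.Binary.PropositionalEquality
  using (_≡_; _≢_; refl; sym; trans; cong; subst; ≢-sym; module ≡-Reasoning)
open import Relation.Binary.Definitions using (tri<; tri≈; tri>)
open import Function using (_∘_)
open import Function.Definitions using (Injective)
open import Function.Bundles using (_⇔_; mk⇔; Equivalence)

private
  variable
    X : Set
    n m k : ℕ

_∈?_ : (a : Fin n) (t : Vec (Fin n) m) → Dec (a ∈ t)
a ∈? t = any? (a ≟_) t

lookup≡⇒∈ : {t : Vec X m} (i : Fin m) {a : X} → lookup t i ≡ a → a ∈ t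
lookup≡⇒∈ {t = t} i eq = subst (_∈ t) eq (∈-lookup i t)

∉-∷ : {a b : X} {t : Vec X m} → a ≢ b → a ∉ t → a ∉ b ∷ t
∉-∷ a≢b a∉t (here a≡b) = a≢b a≡b
∉-∷ a≢b a∉t (there a∈t) = a∉t a∈t

lookup-[]-injective : Injective _≡_ _≡_ (lookup {A = X} [])
lookup-[]-injective {x = ()}

lookup-∷-injective : {a : X} {t : Vec X m} → a ∉ t →
  Injective _≡_ _≡_ (lookup t) → Injective _≡_ _≡_ (lookup (a ∷ t))
lookup-∷-injective a∉t inj {fzero} {fzero} _ = refl
lookup-∷-injective a∉t inj {fzero} {fsuc j} eq = ⊥-elim (a∉t (lookup≡⇒∈ j (sym eq)))
lookup-∷-injective a∉t inj {fsuc i} {fzero} eq = ⊥-elim (a∉t (lookup≡⇒∈ i eq))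
lookup-∷-injective a∉t inj {fsuc i} {fsuc j} eq = cong fsuc (inj eq)

distinct-⊆⇒≤ : {s : Vec (Fin n) m} {t : Vec (Fin n) k} → DistinctTuple s →
  (∀ i → lookup s i ∈ t) → m ≤ k
distinct-⊆⇒≤ {s = s} {t} distinct s⊆t = Fin.injective⇒≤ position-injective
  where
    open ≡-Reasoning
    position-injective : Injective _≡_ _≡_ (λ i → index (s⊆t i))
    position-injective {i} {j} eq = distinct (begin
      lookup s i                 ≡⟨ lookup-index (s⊆t i) ⟩
      lookup t (index (s⊆t i))   ≡⟨ cong (lookup t) eq ⟩
      lookup t (index (s⊆t j))   ≡⟨ lookup-index (s⊆t j) ⟨
      lookup s j                 ∎)

<⇒∃∉ : m < n → (t : Vec (Fin n) m) → ∃ λ w → w ∉ t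
<⇒∃∉ m<n t with Fin.any? (λ w → ¬? (w ∈? t))
... | yes missing = missing
... | no ∄missing = ⊥-elim (ℕ.<⇒≱ m<n (distinct-⊆⇒≤ {s = allFin _} allFin-distinct allFin⊆t))
  where
    allFin-distinct : DistinctTuple (allFin _)
    allFin-distinct {i} {j} eq = trans (sym (lookup-allFin i)) (trans eq (lookup-allFin j))
    allFin⊆t : ∀ i → lookup (allFin _) i ∈ t
    allFin⊆t i = subst (_∈ t) (sym (lookup-allFin i))
      (decidable-stable (i ∈? t) (λ i∉t → ∄missing (i , i∉t)))

distinct-tuple-avoiding : (r : ℕ) (F : Vec (Fin n) m) → m + r ≤ n →
  Σ (Vec (Fin n) r) λ s → DistinctTuple s × (∀ {w} → w ∈ s → w ∉ F)
distinct-tuple-avoiding zero F _ = [] , lookup-[]-injective , λ ()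
distinct-tuple-avoiding {n} {m} (suc r) F m+1+r≤n
  with m+r<n ← subst (_≤ n) (ℕ.+-suc m r) m+1+r≤n
  with distinct-tuple-avoiding r F (ℕ.<⇒≤ m+r<n)
... | s , distinct , s∩F with <⇒∃∉ m+r<n (F ++ s)
... | w , w∉F++s = w ∷ s , lookup-∷-injective (w∉F++s ∘ ∈-++⁺ʳ F) distinct ,
  λ { (here refl) → w∉F++s ∘ ∈-++⁺ˡ ; (there w∈s) → s∩F w∈s }

distinct-tuple-through : 2 ≤ k → m + k ≤ n → {p q : Fin n} (E : Vec (Fin n) m) →
  p ≢ q → p ∉ E → q ∉ E →
  Σ (Vec (Fin n) k) λ s → DistinctTuple s × p ∈ s × q ∈ s × (∀ {w} → w ∈ E → w ∉ s)
distinct-tuple-through {k = suc (suc r)} {m} {n} (s≤s (s≤s _)) m+k≤n {p} {q} E p≢q p∉E q∉E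
  with distinct-tuple-avoiding r (p ∷ q ∷ E)
         (subst (_≤ n) (trans (ℕ.+-suc m (suc r)) (cong suc (ℕ.+-suc m r))) m+k≤n)
... | s , distinct , s∩pqE =
  p ∷ q ∷ s ,
  lookup-∷-injective (∉-∷ p≢q (λ p∈s → s∩pqE p∈s (here refl)))
    (lookup-∷-injective (λ q∈s → s∩pqE q∈s (there (here refl))) distinct) ,
  here refl , there (here refl) ,
  λ { w∈E (here refl) → p∉E w∈E
    ; w∈E (there (here refl)) → q∉E w∈E
    ; w∈E (there (there w∈s)) → s∩pqE w∈s (there (there w∈E)) }

all-but-one-∈ : n ≤ suc k → {t : Vec (Fin n) k} → DistinctTuple t →
  {u w : Fin n} → u ∉ t → w ≢ u → w ∈ t
all-but-one-∈ n≤1+k {t} distinct {u} {w} u∉t w≢u with w ∈? t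
... | yes w∈t = w∈t
... | no w∉t = ⊥-elim (ℕ.<⇒≱ (s≤s n≤1+k)
  (Fin.injective⇒≤ (lookup-∷-injective (∉-∷ (≢-sym w≢u) u∉t) (lookup-∷-injective w∉t distinct))))

∈∉⇒≢ : {a b : X} {t : Vec X m} → a ∈ t → b ∉ t → a ≢ b
∈∉⇒≢ a∈t b∉t refl = b∉t a∈t

precedes⇒∈ˡ : {a : Vec (Fin n) k} {u v : Fin n} → Precedes a u v → u ∈ a
precedes⇒∈ˡ (p , _ , _ , eq , _) = lookup≡⇒∈ p eq

precedes⇒∈ʳ : {a : Vec (Fin n) k} {u v : Fin n} → Precedes a u v → v ∈ a
precedes⇒∈ʳ (_ , q , _ , _ , eq) = lookup≡⇒∈ q eq

precedes-either : {a : Vec (Fin n) k} {u v : Fin n} → u ∈ a → v ∈ a → u ≢ v →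
  Precedes a u v ⊎ Precedes a v u
precedes-either {a = a} u∈a v∈a u≢v with Fin.<-cmp (index u∈a) (index v∈a)
... | tri< lt _ _ = inj₁ (index u∈a , index v∈a , lt , sym (lookup-index u∈a) , sym (lookup-index v∈a))
... | tri≈ _ eq _ = ⊥-elim (u≢v (trans (lookup-index u∈a) (trans (cong (lookup a) eq) (sym (lookup-index v∈a)))))
... | tri> _ _ gt = inj₂ (index v∈a , index u∈a , gt , sym (lookup-index v∈a) , sym (lookup-index u∈a))

sameEntries⇒≢ : {c s a : Vec (Fin n) k} {γ : Fin n} → SameEntries c s → γ ∈ a → γ ∉ s → c ≢ a
sameEntries⇒≢ c≈s γ∈a γ∉s refl = γ∉s (Equivalence.to (c≈s _) γ∈a)

off-path : {y : Fin n} {vs : Vec (Fin n) m} → y ∉ vs → ∀ i → lookup vs i ≢ y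
off-path y∉vs i eq = y∉vs (lookup≡⇒∈ i eq)

compEdge-sym : {T : HyperTournament n k} {i j : ℕ} {x y : Fin n} →
  CompEdge i j T x y → CompEdge i j T y x
compEdge-sym (z , z≢x , z≢y , P , Q , y∉P , x∉Q , lengths , disjoint) =
  z , z≢y , z≢x , Q , P , x∉Q , y∉P , Sum.swap lengths , λ a b eq → disjoint b a (sym eq)

compEdge-mono : {T : HyperTournament n k} {i j i′ j′ : ℕ} {x y : Fin n} →
  i ≤ i′ → j ≤ j′ → CompEdge i j T x y → CompEdge i′ j′ T x y
compEdge-mono i≤i′ j≤j′ (z , z≢x , z≢y , P , Q , y∉P , x∉Q , lengths , disjoint) =
  z , z≢x , z≢y , P , Q , y∉P , x∉Q ,
  Sum.map (λ (p , q) → ℕ.≤-trans p i≤i′ , ℕ.≤-trans q j≤j′)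
          (λ (q , p) → ℕ.≤-trans q i≤i′ , ℕ.≤-trans p j≤j′) lengths ,
  disjoint

module _ {n k : ℕ} (T : HyperTournament n k) where

  missing-same⇒≡ : n ≤ suc k → {a b : Vec (Fin n) k} {u : Fin n} →
    arc T a → arc T b → u ∉ a → u ∉ b → a ≡ b
  missing-same⇒≡ n≤1+k {a} {b} a-arc b-arc u∉a u∉b = arc-unique T a b a-arc b-arc λ w → mk⇔
    (λ w∈a → all-but-one-∈ n≤1+k (arc-distinct T b b-arc) u∉b (∈∉⇒≢ w∈a u∉a))
    (λ w∈b → all-but-one-∈ n≤1+k (arc-distinct T a a-arc) u∉a (∈∉⇒≢ w∈b u∉b))

  arc-misses-one-of : n ≤ suc k → k ≤ 3 → k < n → {e : Vec (Fin n) k} → arc T e →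
    {x y p q : Fin n} → x ≢ y → p ≢ q → p ≢ x → p ≢ y → q ≢ x → q ≢ y →
    p ∈ e → q ∈ e → y ∉ e ⊎ x ∉ e
  arc-misses-one-of n≤1+k k≤3 k<n {e} e-arc {x} {y} {p} {q} x≢y p≢q p≢x p≢y q≢x q≢y p∈e q∈e
    with <⇒∃∉ k<n e
  ... | m , m∉e with m ≟ y | m ≟ x
  ... | yes refl | _ = inj₁ m∉e
  ... | no _ | yes refl = inj₂ m∉e
  ... | no m≢y | no m≢x = ⊥-elim (ℕ.<⇒≱ (s≤s k≤3) (distinct-⊆⇒≤ {s = x ∷ y ∷ p ∷ q ∷ []} xypq-distinct xypq⊆e))
    where
      xypq-distinct : DistinctTuple (x ∷ y ∷ p ∷ q ∷ [])
      xypq-distinct =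
        lookup-∷-injective (∉-∷ x≢y (∉-∷ (≢-sym p≢x) (∉-∷ (≢-sym q≢x) λ ())))
          (lookup-∷-injective (∉-∷ (≢-sym p≢y) (∉-∷ (≢-sym q≢y) λ ()))
            (lookup-∷-injective (∉-∷ p≢q λ ()) (lookup-∷-injective (λ ()) lookup-[]-injective)))
      xypq⊆e : ∀ i → lookup (x ∷ y ∷ p ∷ q ∷ []) i ∈ e
      xypq⊆e fzero = all-but-one-∈ n≤1+k (arc-distinct T e e-arc) m∉e (≢-sym m≢x)
      xypq⊆e (fsuc fzero) = all-but-one-∈ n≤1+k (arc-distinct T e e-arc) m∉e (≢-sym m≢y)
      xypq⊆e (fsuc (fsuc fzero)) = p∈e
      xypq⊆e (fsuc (fsuc (fsuc fzero))) = q∈e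

  unit-path : {a : Vec (Fin n) k} {u v : Fin n} → arc T a → Precedes a u v → u ≢ v → Path T u v
  unit-path {a} {u} {v} a-arc u≺v u≢v = record
    { len = 1
    ; vert = lookup (u ∷ v ∷ [])
    ; arcs = λ _ → a
    ; vert-inj = lookup-∷-injective (∉-∷ u≢v λ ()) (lookup-∷-injective (λ ()) lookup-[]-injective)
    ; arcs-inj = λ { {fzero} {fzero} _ → refl }
    ; arcs-in = λ _ → a-arc
    ; steps = λ { fzero → u≺v }
    ; start = refl
    ; end = refl
    }

  two-step-path : {a b : Vec (Fin n) k} {u v w : Fin n} → arc T a → arc T b → a ≢ b →
    Precedes a u v → Precedes b v w → u ≢ v → u ≢ w → v ≢ w → Path T u w
  two-step-path {a} {b} {u} {v} {w} a-arc b-arc a≢b u≺v v≺w u≢v u≢w v≢w = record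
    { len = 2
    ; vert = lookup (u ∷ v ∷ w ∷ [])
    ; arcs = lookup (a ∷ b ∷ [])
    ; vert-inj = lookup-∷-injective (∉-∷ u≢v (∉-∷ u≢w λ ()))
        (lookup-∷-injective (∉-∷ v≢w λ ()) (lookup-∷-injective (λ ()) lookup-[]-injective))
    ; arcs-inj = lookup-∷-injective (∉-∷ a≢b λ ()) (lookup-∷-injective (λ ()) lookup-[]-injective)
    ; arcs-in = λ { fzero → a-arc ; (fsuc fzero) → b-arc }
    ; steps = λ { fzero → u≺v ; (fsuc fzero) → v≺w }
    ; start = refl
    ; end = refl
    }

  vert-≢ : {x z : Fin n} (P : Path T x z) {i j : Fin (suc (len P))} → i ≢ j → vert P i ≢ vert P j
  vert-≢ P i≢j = i≢j ∘ vert-inj P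

  arcs-≢ : {x z : Fin n} (P : Path T x z) {i j : Fin (len P)} → i ≢ j → arcs P i ≢ arcs P j
  arcs-≢ P i≢j = i≢j ∘ arcs-inj P

  record Departure {x z : Fin n} (P : Path T x z) (y : Fin n) : Set where
    field
      first  : Fin (len P)
      next   : Fin n
      leaves : Precedes (arcs P first) x next
      next≢x : next ≢ x
      next≢y : next ≢ y
      onward : z ≡ next ⊎ Σ (Fin (len P)) λ second → arcs P second ≢ arcs P first ×
                 Σ (Fin n) λ q → next ∈ arcs P second × q ∈ arcs P second ×
                   q ≢ next × q ≢ x × q ≢ y

  departure : {x y z : Fin n} (P : Path T x z) → z ≢ x → NotOn y P → Departure P y
  departure P@record { len = zero } z≢x _ = ⊥-elim (z≢x (trans (sym (end P)) (start P)))
  departure P@record { len = suc zero } z≢x y∉P = record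
    { first = fzero
    ; next = vert P (fsuc fzero)
    ; leaves = subst (λ u → Precedes (arcs P fzero) u _) (start P) (steps P fzero)
    ; next≢x = λ eq → vert-≢ P (λ ()) (trans eq (sym (start P)))
    ; next≢y = y∉P (fsuc fzero)
    ; onward = inj₁ (sym (end P))
    }
  departure P@record { len = suc (suc l) } z≢x y∉P = record
    { first = fzero
    ; next = vert P (fsuc fzero)
    ; leaves = subst (λ u → Precedes (arcs P fzero) u _) (start P) (steps P fzero)
    ; next≢x = λ eq → vert-≢ P (λ ()) (trans eq (sym (start P)))
    ; next≢y = y∉P (fsuc fzero)
    ; onward = inj₂ (fsuc fzero , arcs-≢ P (λ ()) , vert P (fsuc (fsuc fzero)) ,
        precedes⇒∈ˡ (steps P (fsuc fzero)) , precedes⇒∈ʳ (steps P (fsuc fzero)) ,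
        vert-≢ P (λ ()) , (λ eq → vert-≢ P (λ ()) (trans eq (sym (start P)))) ,
        y∉P (fsuc (fsuc fzero)))
    }

  Continues : (a b : Vec (Fin n) k) (x y x₁ z : Fin n) → Set
  Continues a b x y x₁ z = z ≡ x₁ ⊎ Σ (Vec (Fin n) k) λ e → arc T e × e ≢ a × e ≢ b ×
    Σ (Fin n) λ q → x₁ ∈ e × q ∈ e × q ≢ x₁ × q ≢ x × q ≢ y

  departure-continues : {x y z : Fin n} {P : Path T x z} (d : Departure P y) {b : Vec (Fin n) k} →
    (∀ i → arcs P i ≢ b) → Continues (arcs P (Departure.first d)) b x y (Departure.next d) z
  departure-continues {P = P} d avoids-b with Departure.onward d
  ... | inj₁ z≡next = inj₁ z≡next
  ... | inj₂ (second , second≢first , q , onward) =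
    inj₂ (arcs P second , arcs-in P second , second≢first , avoids-b second , q , onward)

  record Fork (x y : Fin n) : Set where
    field
      A B   : Vec (Fin n) k
      x₁ y₁ : Fin n
      A-arc : arc T A
      B-arc : arc T B
      A≢B   : A ≢ B
      x≺x₁  : Precedes A x x₁
      y≺y₁  : Precedes B y y₁
      x≢y   : x ≢ y
      x₁≢x  : x₁ ≢ x
      x₁≢y  : x₁ ≢ y
      y₁≢y  : y₁ ≢ y
      y₁≢x  : y₁ ≢ x

  swap : {x y : Fin n} → Fork x y → Fork y x
  swap F = record
    { A = B ; B = A ; x₁ = y₁ ; y₁ = x₁ ; A-arc = B-arc ; B-arc = A-arc ; A≢B = ≢-sym A≢B
    ; x≺x₁ = y≺y₁ ; y≺y₁ = x≺x₁ ; x≢y = ≢-sym x≢y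
    ; x₁≢x = y₁≢y ; x₁≢y = y₁≢x ; y₁≢y = x₁≢x ; y₁≢x = x₁≢y }
    where open Fork F

  fork-of-edge : {i j : ℕ} {x y : Fin n} → CompEdge i j T x y →
    Σ (Fin n) λ z → Σ (Fork x y) λ F →
      Continues (Fork.A F) (Fork.B F) x y (Fork.x₁ F) z ×
      Continues (Fork.B F) (Fork.A F) y x (Fork.y₁ F) z
  fork-of-edge (z , z≢x , z≢y , P , Q , y∉P , x∉Q , _ , disjoint) =
    z , F , departure-continues dP (λ i → disjoint i (first dQ)) ,
            departure-continues dQ (λ j eq → disjoint (first dP) j (sym eq))
    where
      open Departure
      dP = departure P z≢x y∉P
      dQ = departure Q z≢y x∉Q
      F = record
        { A = arcs P (first dP) ; B = arcs Q (first dQ) ; x₁ = next dP ; y₁ = next dQ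
        ; A-arc = arcs-in P (first dP) ; B-arc = arcs-in Q (first dQ)
        ; A≢B = disjoint (first dP) (first dQ)
        ; x≺x₁ = leaves dP ; y≺y₁ = leaves dQ
        ; x≢y = λ x≡y → y∉P fzero (trans (start P) x≡y)
        ; x₁≢x = next≢x dP ; x₁≢y = next≢y dP ; y₁≢y = next≢x dQ ; y₁≢x = next≢y dQ }

  module _ {x y : Fin n} (F : Fork x y) where
    open Fork F

    merge : x₁ ≡ y₁ → CompEdge 1 2 T x y
    merge x₁≡y₁ =
      x₁ , x₁≢x , x₁≢y ,
      unit-path A-arc x≺x₁ (≢-sym x₁≢x) ,
      unit-path B-arc (subst (Precedes B y) (sym x₁≡y₁) y≺y₁) (≢-sym x₁≢y) ,
      off-path (∉-∷ (≢-sym x≢y) (∉-∷ (≢-sym x₁≢y) λ ())) ,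
      off-path (∉-∷ x≢y (∉-∷ (≢-sym x₁≢x) λ ())) ,
      inj₁ (s≤s z≤n , s≤s z≤n) ,
      λ { fzero fzero → A≢B }

    detour : {c : Vec (Fin n) k} → arc T c → c ≢ A → c ≢ B →
      Precedes c x₁ y₁ → x₁ ≢ y₁ → CompEdge 1 2 T x y
    detour c-arc c≢A c≢B x₁≺y₁ x₁≢y₁ =
      y₁ , y₁≢x , y₁≢y ,
      two-step-path A-arc c-arc (≢-sym c≢A) x≺x₁ x₁≺y₁ (≢-sym x₁≢x) (≢-sym y₁≢x) x₁≢y₁ ,
      unit-path B-arc y≺y₁ (≢-sym y₁≢y) ,
      off-path (∉-∷ (≢-sym x≢y) (∉-∷ (≢-sym x₁≢y) (∉-∷ (≢-sym y₁≢y) λ ()))) ,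
      off-path (∉-∷ x≢y (∉-∷ (≢-sym y₁≢x) λ ())) ,
      inj₂ (s≤s z≤n , s≤s (s≤s z≤n)) ,
      λ { fzero fzero → A≢B ; (fsuc fzero) fzero → c≢B }

  module _ {x y : Fin n} (F : Fork x y) where
    open Fork F

    -- The arc on the entries of s orders x₁ and y₁ one way or the other; either
    -- way it extends one of the two first steps by a second one.
    edge-through : x₁ ≢ y₁ → {s : Vec (Fin n) k} → DistinctTuple s → x₁ ∈ s → y₁ ∈ s →
      (∃ λ γ → γ ∈ A × γ ∉ s) → (∃ λ δ → δ ∈ B × δ ∉ s) → CompEdge 1 2 T x y
    edge-through x₁≢y₁ {s} s-distinct x₁∈s y₁∈s (γ , γ∈A , γ∉s) (δ , δ∈B , δ∉s)
      with arc-exists T s s-distinct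
    ... | c , c-arc , c≈s
      with c≢A ← sameEntries⇒≢ c≈s γ∈A γ∉s
      with c≢B ← sameEntries⇒≢ c≈s δ∈B δ∉s
      with precedes-either (Equivalence.from (c≈s x₁) x₁∈s) (Equivalence.from (c≈s y₁) y₁∈s) x₁≢y₁
    ... | inj₁ x₁≺y₁ = detour F c-arc c≢A c≢B x₁≺y₁ x₁≢y₁
    ... | inj₂ y₁≺x₁ = compEdge-sym (detour (swap F) c-arc c≢B c≢A y₁≺x₁ (≢-sym x₁≢y₁))

    edge-avoiding : 2 ≤ k → x₁ ≢ y₁ → {m : ℕ} (E : Vec (Fin n) m) → m + k ≤ n →
      x₁ ∉ E → y₁ ∉ E → (∃ λ γ → γ ∈ A × γ ∈ E) → (∃ λ δ → δ ∈ B × δ ∈ E) →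
      CompEdge 1 2 T x y
    edge-avoiding 2≤k x₁≢y₁ E m+k≤n x₁∉E y₁∉E (γ , γ∈A , γ∈E) (δ , δ∈B , δ∈E)
      with distinct-tuple-through 2≤k m+k≤n E x₁≢y₁ x₁∉E y₁∉E
    ... | s , s-distinct , x₁∈s , y₁∈s , E∩s =
      edge-through x₁≢y₁ s-distinct x₁∈s y₁∈s (γ , γ∈A , E∩s γ∈E) (δ , δ∈B , E∩s δ∈E)

    x∈B⇒edge : 2 ≤ k → k < n → x₁ ≢ y₁ → x ∈ B → CompEdge 1 2 T x y
    x∈B⇒edge 2≤k k<n x₁≢y₁ x∈B =
      edge-avoiding 2≤k x₁≢y₁ (x ∷ []) k<n (∉-∷ x₁≢x λ ()) (∉-∷ y₁≢x λ ())
        (x , precedes⇒∈ˡ x≺x₁ , here refl) (x , x∈B , here refl)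

  module _ {x y : Fin n} (F : Fork x y) where
    open Fork F

    Tight : Set
    Tight = n ≤ suc k × k ≤ 3 × y ∉ A × x ∉ B

    edge-unless-tight : 2 ≤ k → k < n → x₁ ≢ y₁ → CompEdge 1 2 T x y ⊎ Tight
    edge-unless-tight 2≤k k<n x₁≢y₁ with x ∈? B | y ∈? A | 2 + k ≤? n | 4 ≤? k
    ... | yes x∈B | _ | _ | _ = inj₁ (x∈B⇒edge F 2≤k k<n x₁≢y₁ x∈B)
    ... | no _ | yes y∈A | _ | _ =
      inj₁ (compEdge-sym (x∈B⇒edge (swap F) 2≤k k<n (≢-sym x₁≢y₁) y∈A))
    ... | no _ | no _ | yes 2+k≤n | _ =
      inj₁ (edge-avoiding F 2≤k x₁≢y₁ (x ∷ y ∷ []) 2+k≤n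
        (∉-∷ x₁≢x (∉-∷ x₁≢y λ ())) (∉-∷ y₁≢x (∉-∷ y₁≢y λ ()))
        (x , precedes⇒∈ˡ x≺x₁ , here refl) (y , precedes⇒∈ˡ y≺y₁ , there (here refl)))
    ... | no x∉B | no y∉A | no 2+k≰n | no 4≰k = inj₂ (ℕ.≮⇒≥ 2+k≰n , ℕ.≮⇒≥ 4≰k , y∉A , x∉B)
    ... | no x∉B | no y∉A | no 2+k≰n | yes 4≤k
      with <⇒∃∉ (ℕ.≤-trans (s≤s 4≤k) k<n) (x ∷ y ∷ x₁ ∷ y₁ ∷ [])
    ...   | w , w∉xyx₁y₁ =
      inj₁ (edge-avoiding F 2≤k x₁≢y₁ (w ∷ []) k<n
        (∉-∷ (λ x₁≡w → w∉xyx₁y₁ (there (there (here (sym x₁≡w))))) λ ())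
        (∉-∷ (λ y₁≡w → w∉xyx₁y₁ (there (there (there (here (sym y₁≡w)))))) λ ())
        (w , all-but-one-∈ n≤1+k (arc-distinct T A A-arc) y∉A (w∉xyx₁y₁ ∘ there ∘ here) , here refl)
        (w , all-but-one-∈ n≤1+k (arc-distinct T B B-arc) x∉B (w∉xyx₁y₁ ∘ here) , here refl))
      where n≤1+k = ℕ.≮⇒≥ 2+k≰n

    -- In the tight configuration every arc through two vertices outside {x, y} is A or B.
    tight-continuation : k < n → Tight → {z : Fin n} → Continues A B x y x₁ z → z ≡ x₁
    tight-continuation k<n _ (inj₁ z≡x₁) = z≡x₁
    tight-continuation k<n (n≤1+k , k≤3 , y∉A , x∉B)
      (inj₂ (e , e-arc , e≢A , e≢B , q , x₁∈e , q∈e , q≢x₁ , q≢x , q≢y)) =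
      ⊥-elim ([ e≢A ∘ (λ y∉e → missing-same⇒≡ n≤1+k e-arc A-arc y∉e y∉A)
              , e≢B ∘ (λ x∉e → missing-same⇒≡ n≤1+k e-arc B-arc x∉e x∉B) ]′
        (arc-misses-one-of n≤1+k k≤3 k<n e-arc x≢y (≢-sym q≢x₁) x₁≢x x₁≢y q≢x q≢y x₁∈e q∈e))

  compEdge⇒compEdge₁₂ : 2 ≤ k → k < n → {i j : ℕ} {x y : Fin n} →
    CompEdge i j T x y → CompEdge 1 2 T x y
  compEdge⇒compEdge₁₂ 2≤k k<n edge with fork-of-edge edge
  ... | z , F , continues-x , continues-y with Fork.x₁ F ≟ Fork.y₁ F
  ...   | yes x₁≡y₁ = merge F x₁≡y₁
  ...   | no x₁≢y₁ with edge-unless-tight F 2≤k k<n x₁≢y₁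
  ...     | inj₁ edge₁₂ = edge₁₂
  ...     | inj₂ tight@(n≤1+k , k≤3 , y∉A , x∉B) =
    ⊥-elim (x₁≢y₁ (trans (sym (tight-continuation F k<n tight continues-x))
                         (tight-continuation (swap F) k<n (n≤1+k , k≤3 , x∉B , y∉A) continues-y)))

≤∸1⇒< : {k n : ℕ} → 1 ≤ k → k ≤ n ∸ 1 → k < n
≤∸1⇒< {n = zero} (s≤s _) ()
≤∸1⇒< {n = suc n} _ k≤n = s≤s k≤n

theorem6p2 : (n k : ℕ) (T : HyperTournament n k) → 3 ≤ k → k ≤ n ∸ 1 →
    (i j : ℕ) → 1 ≤ i → 2 ≤ j →
    (x y : Fin n) → CompEdge i j T x y ⇔ CompEdge 1 2 T x y
theorem6p2 n k T 3≤k k≤n∸1 i j 1≤i 2≤j x y =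
  mk⇔ (compEdge⇒compEdge₁₂ T (ℕ.<⇒≤ 3≤k) k<n) (compEdge-mono 1≤i 2≤j)
  where k<n = ≤∸1⇒< (ℕ.≤-trans (s≤s z≤n) 3≤k) k≤n∸1
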